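{- Let $n$ and $t$ be positive integers with $n\geq t+2$. Suppose $\mathcal{T}\subseteq \binom{[n]}{t+1}$ is a $t$-intersecting family with $|\mathcal{T}|\geq 2$. If there exist two $t$-covers $A$ and $B$ of $\mathcal{T}$ with $|A\cap B|<t$, then $\bigcap_{T\in\mathcal{T}}T\in\binom{A}{t}\cup \binom{B}{t}$.
   Context: A family is $t$-intersecting if any two of its members share at least $t$ elements. A set $X\subseteq[n]$ is a $t$-cover of $\mathcal{T}$ if $|X\cap T|\geq t$ for all $T\in\mathcal{T}$. $\binom{A}{t}$ is the family of $t$-subsets of $A$. -}

module Defs where

open import Data.Nat using (ℕ; _≥_)
open import Data.Fin.Subset using (Subset; ∣_∣; _∩_; ⊤; _⊆_)
open import Data.List using (List; foldr)
open import Data.List.Membership.Propositional using (_∈_)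
open import Data.Product using (_×_)
open import Relation.Binary.PropositionalEquality using (_≡_)

Uniform : ∀ {n} → ℕ → List (Subset n) → Set
Uniform k 𝒯 = ∀ {T} → T ∈ 𝒯 → ∣ T ∣ ≡ k

TIntersecting : ∀ {n} → ℕ → List (Subset n) → Set
TIntersecting t 𝒯 = ∀ {S T} → S ∈ 𝒯 → T ∈ 𝒯 → ∣ S ∩ T ∣ ≥ t

TCover : ∀ {n} → ℕ → List (Subset n) → Subset n → Set
TCover t 𝒯 X = ∀ {T} → T ∈ 𝒯 → ∣ X ∩ T ∣ ≥ t

⋂ : ∀ {n} → List (Subset n) → Subset n
⋂ = foldr _∩_ ⊤

InChoose : ∀ {n} → Subset n → ℕ → Subset n → Set
InChoose A t X = X ⊆ A × ∣ X ∣ ≡ t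

{-# OPTIONS --safe #-}
-- Counting |T ∩ A| + |T ∩ B| = |T ∩ (A ∩ B)| + |T ∩ (A ∪ B)| ≤ (t − 1) + (t + 1)
-- against the cover bounds |T ∩ A|, |T ∩ B| ≥ t leaves no slack: every member T
-- of 𝒯 is A ∩ B (of size t − 1) plus one point of A ∖ B and one point of B ∖ A.
-- Two members meet in t points only if they share their A-point or their B-point,
-- and two distinct members T₁, T₂ share exactly one of them, say the A-point a.
-- Any further member shares its A-point or its B-point with each of T₁ and T₂,
-- and sharing B-points with both is impossible, so it contains K = (A ∩ B) + a.
-- Hence K ⊆ ⋂ 𝒯 ⊆ T₁ ∩ T₂, and |T₁ ∩ T₂| ≤ t = |K| gives ⋂ 𝒯 = K ⊆ A.
module Submission where

open import Defs
open import Data.Nat using (ℕ; suc; _≥_; _<_; _+_; _≤_; s≤s; s≤s⁻¹)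
open import Data.Nat.Properties
  using ( ≤-trans; ≤-reflexive; ≤-antisym; ≤⇒≯; ≰⇒>; ≮⇒≥; _<?_; +-suc
        ; +-mono-≤; +-monoˡ-≤; +-monoʳ-≤; +-monoʳ-<; +-cancelˡ-≤; +-cancelʳ-≤; +-cancelˡ-<
        ; module ≤-Reasoning )
open import Data.Fin.Subset using (Subset; ∣_∣; _∩_; _∪_; _⊆_; inside; outside)
open import Data.Fin.Subset.Properties
  using ( ⊆-refl; ⊆-trans; ⊆-antisym; ⊆⊤; drop-∷-⊆; out⊆; in⊆in; p⊆q⇒∣p∣≤∣q∣
        ; p∩q⊆p; p∩q⊆q; x∈p∩q⁺; ∣p∩q∣≤∣p∣; ∣p∩q∣≤∣q∣; ∩-comm; ∩-distribˡ-∪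
        ; ∩-idempotentCommutativeMonoid )
import Algebra.Solver.IdempotentCommutativeMonoid as ∩-Solver
open import Data.List using (List; length; []; _∷_)
open import Data.List.Membership.Propositional using (_∈_)
open import Data.List.Relation.Unary.Any using (here; there)
open import Data.List.Relation.Unary.All using (_∷_)
open import Data.List.Relation.Unary.AllPairs using (_∷_)
open import Data.List.Relation.Unary.Unique.Propositional using (Unique)
open import Data.Vec using ([]; _∷_; here)
open import Data.Product using (_×_; _,_; proj₁; proj₂)
open import Data.Sum using (_⊎_; inj₁; inj₂)
import Data.Sum as Sum
open import Data.Empty using (⊥-elim)
open import Function using (_∘_)
open import Relation.Nullary using (yes; no)
open import Relation.Binary.PropositionalEquality
  using (_≡_; _≢_; refl; sym; trans; cong; cong₂; subst; module ≡-Reasoning)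

private
  variable
    n t : ℕ
    p q r A B T T′ : Subset n
    𝒯 : List (Subset n)

+-tight : ∀ {a b m k} → a ≤ m → b ≤ k → m + k ≤ a + b → a ≡ m × b ≡ k
+-tight {a} {b} {m} {k} a≤m b≤k m+k≤a+b =
  ≤-antisym a≤m (+-cancelʳ-≤ k m a (≤-trans m+k≤a+b (+-monoʳ-≤ a b≤k))) ,
  ≤-antisym b≤k (+-cancelˡ-≤ m k b (≤-trans m+k≤a+b (+-monoˡ-≤ b a≤m)))

m+n<o+p⇒m<o⊎n<p : ∀ {m n o p} → m + n < o + p → m < o ⊎ n < p
m+n<o+p⇒m<o⊎n<p {m} {n} {o} {p} m+n<o+p with m <? o
... | yes m<o = inj₁ m<o
... | no m≮o  = inj₂ (+-cancelˡ-< m n p (≤-trans m+n<o+p (+-monoˡ-≤ p (≮⇒≥ m≮o))))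

∣p∩q∣+∣p∪q∣≡∣p∣+∣q∣ : (p q : Subset n) → ∣ p ∩ q ∣ + ∣ p ∪ q ∣ ≡ ∣ p ∣ + ∣ q ∣
∣p∩q∣+∣p∪q∣≡∣p∣+∣q∣ []            []            = refl
∣p∩q∣+∣p∪q∣≡∣p∣+∣q∣ (inside ∷ p)  (inside ∷ q)  =
  cong suc (trans (+-suc _ _) (trans (cong suc (∣p∩q∣+∣p∪q∣≡∣p∣+∣q∣ p q)) (sym (+-suc _ _))))
∣p∩q∣+∣p∪q∣≡∣p∣+∣q∣ (inside ∷ p)  (outside ∷ q) =
  trans (+-suc _ _) (cong suc (∣p∩q∣+∣p∪q∣≡∣p∣+∣q∣ p q))
∣p∩q∣+∣p∪q∣≡∣p∣+∣q∣ (outside ∷ p) (inside ∷ q)  =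
  trans (+-suc _ _) (trans (cong suc (∣p∩q∣+∣p∪q∣≡∣p∣+∣q∣ p q)) (sym (+-suc _ _)))
∣p∩q∣+∣p∪q∣≡∣p∣+∣q∣ (outside ∷ p) (outside ∷ q) = ∣p∩q∣+∣p∪q∣≡∣p∣+∣q∣ p q

∩-distribˡ-∩ : (r p q : Subset n) → r ∩ (p ∩ q) ≡ (r ∩ p) ∩ (r ∩ q)
∩-distribˡ-∩ {n} = solve 3 (λ r p q → r ⊕ (p ⊕ q) ⊜ (r ⊕ p) ⊕ (r ⊕ q)) refl
  where open ∩-Solver (∩-idempotentCommutativeMonoid n)

∣r∩p∣+∣r∩q∣≡∣r∩[p∩q]∣+∣r∩[p∪q]∣ : (r p q : Subset n) →
  ∣ r ∩ p ∣ + ∣ r ∩ q ∣ ≡ ∣ r ∩ (p ∩ q) ∣ + ∣ r ∩ (p ∪ q) ∣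
∣r∩p∣+∣r∩q∣≡∣r∩[p∩q]∣+∣r∩[p∪q]∣ r p q = begin
  ∣ r ∩ p ∣ + ∣ r ∩ q ∣                         ≡⟨ ∣p∩q∣+∣p∪q∣≡∣p∣+∣q∣ (r ∩ p) (r ∩ q) ⟨
  ∣ (r ∩ p) ∩ (r ∩ q) ∣ + ∣ (r ∩ p) ∪ (r ∩ q) ∣ ≡⟨ cong₂ (λ x y → ∣ x ∣ + ∣ y ∣)
                                                      (∩-distribˡ-∩ r p q) (∩-distribˡ-∪ r p q) ⟨
  ∣ r ∩ (p ∩ q) ∣ + ∣ r ∩ (p ∪ q) ∣             ∎
  where open ≡-Reasoning

⊆-∩ : r ⊆ p → r ⊆ q → r ⊆ p ∩ q
⊆-∩ r⊆p r⊆q x∈r = x∈p∩q⁺ (r⊆p x∈r , r⊆q x∈r)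

p⊆q∧∣q∣≤∣p∣⇒q⊆p : p ⊆ q → ∣ q ∣ ≤ ∣ p ∣ → q ⊆ p
p⊆q∧∣q∣≤∣p∣⇒q⊆p {p = []}          {[]}          _   _ = ⊆-refl
p⊆q∧∣q∣≤∣p∣⇒q⊆p {p = outside ∷ p} {outside ∷ q} p⊆q ∣q∣≤∣p∣ =
  out⊆ (p⊆q∧∣q∣≤∣p∣⇒q⊆p (drop-∷-⊆ p⊆q) ∣q∣≤∣p∣)
p⊆q∧∣q∣≤∣p∣⇒q⊆p {p = outside ∷ p} {inside ∷ q}  p⊆q ∣q∣≤∣p∣ =
  ⊥-elim (≤⇒≯ (p⊆q⇒∣p∣≤∣q∣ (drop-∷-⊆ p⊆q)) ∣q∣≤∣p∣)
p⊆q∧∣q∣≤∣p∣⇒q⊆p {p = inside ∷ p}  {outside ∷ q} p⊆q _ with p⊆q here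
... | ()
p⊆q∧∣q∣≤∣p∣⇒q⊆p {p = inside ∷ p}  {inside ∷ q}  p⊆q ∣q∣≤∣p∣ =
  in⊆in (p⊆q∧∣q∣≤∣p∣⇒q⊆p (drop-∷-⊆ p⊆q) (s≤s⁻¹ ∣q∣≤∣p∣))

p⊆q∧∣q∣≤∣p∣⇒p≡q : p ⊆ q → ∣ q ∣ ≤ ∣ p ∣ → p ≡ q
p⊆q∧∣q∣≤∣p∣⇒p≡q p⊆q ∣q∣≤∣p∣ = ⊆-antisym p⊆q (p⊆q∧∣q∣≤∣p∣⇒q⊆p p⊆q ∣q∣≤∣p∣)

∣p∣≡∣q∣∧p≢q⇒∣p∩q∣<∣p∣ : ∣ p ∣ ≡ ∣ q ∣ → p ≢ q → ∣ p ∩ q ∣ < ∣ p ∣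
∣p∣≡∣q∣∧p≢q⇒∣p∩q∣<∣p∣ {p = p} {q} ∣p∣≡∣q∣ p≢q = ≰⇒> λ ∣p∣≤∣p∩q∣ →
  let p⊆q = subst (_⊆ q) (p⊆q∧∣q∣≤∣p∣⇒p≡q (p∩q⊆p p q) ∣p∣≤∣p∩q∣) (p∩q⊆q p q)
  in  p≢q (p⊆q∧∣q∣≤∣p∣⇒p≡q p⊆q (≤-reflexive (sym ∣p∣≡∣q∣)))

p⊆q∪r⇒p≡p∩q∪p∩r : p ⊆ q ∪ r → p ≡ (p ∩ q) ∪ (p ∩ r)
p⊆q∪r⇒p≡p∩q∪p∩r {p = p} {q} {r} p⊆q∪r =
  trans (sym (⊆-antisym (p∩q⊆p p (q ∪ r)) (⊆-∩ ⊆-refl p⊆q∪r))) (∩-distribˡ-∪ p q r)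

⋂-⊆ : T ∈ 𝒯 → ⋂ 𝒯 ⊆ T
⋂-⊆ (here refl) = p∩q⊆p _ _
⋂-⊆ (there T∈𝒯) = ⊆-trans (p∩q⊆q _ _) (⋂-⊆ T∈𝒯)

⊆-⋂ : (∀ {T} → T ∈ 𝒯 → r ⊆ T) → r ⊆ ⋂ 𝒯
⊆-⋂ {𝒯 = []}    _   = ⊆⊤
⊆-⋂ {𝒯 = _ ∷ _} r⊆ = ⊆-∩ (r⊆ (here refl)) (⊆-⋂ (r⊆ ∘ there))

record Straddles (t : ℕ) (A B T : Subset n) : Set where
  field
    suc∣A∩B∣≡t : suc ∣ A ∩ B ∣ ≡ t
    A∩B⊆T      : A ∩ B ⊆ T
    T⊆A∪B      : T ⊆ A ∪ B
    ∣T∩A∣≡t    : ∣ T ∩ A ∣ ≡ t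
    ∣T∩B∣≡t    : ∣ T ∩ B ∣ ≡ t

open Straddles

straddles : ∣ T ∣ ≡ suc t → t ≤ ∣ A ∩ T ∣ → t ≤ ∣ B ∩ T ∣ → ∣ A ∩ B ∣ < t → Straddles t A B T
straddles {T = T} {t} {A} {B} ∣T∣≡1+t t≤∣A∩T∣ t≤∣B∩T∣ ∣A∩B∣<t = record
  { suc∣A∩B∣≡t = ≤-antisym ∣A∩B∣<t t≤1+e
  ; A∩B⊆T      = subst (_⊆ T) T∩[A∩B]≡A∩B (p∩q⊆p T (A ∩ B))
  ; T⊆A∪B      = subst (_⊆ A ∪ B) T∩[A∪B]≡T (p∩q⊆q T (A ∪ B))
  ; ∣T∩A∣≡t    = sym (proj₁ t≡a×t≡b)
  ; ∣T∩B∣≡t    = sym (proj₂ t≡a×t≡b)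
  }
  where
  open ≤-Reasoning
  a b c d e : ℕ
  a = ∣ T ∩ A ∣
  b = ∣ T ∩ B ∣
  c = ∣ T ∩ (A ∩ B) ∣
  d = ∣ T ∩ (A ∪ B) ∣
  e = ∣ A ∩ B ∣
  t≤a : t ≤ a
  t≤a = subst (t ≤_) (cong ∣_∣ (∩-comm A T)) t≤∣A∩T∣
  t≤b : t ≤ b
  t≤b = subst (t ≤_) (cong ∣_∣ (∩-comm B T)) t≤∣B∩T∣
  c≤e : c ≤ e
  c≤e = ∣p∩q∣≤∣q∣ T (A ∩ B)
  d≤1+t : d ≤ suc t
  d≤1+t = subst (d ≤_) ∣T∣≡1+t (∣p∩q∣≤∣p∣ T (A ∪ B))
  t+t≤c+d : t + t ≤ c + d
  t+t≤c+d = begin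
    t + t ≤⟨ +-mono-≤ t≤a t≤b ⟩
    a + b ≡⟨ ∣r∩p∣+∣r∩q∣≡∣r∩[p∩q]∣+∣r∩[p∪q]∣ T A B ⟩
    c + d ∎
  c+d≤1+e+t : c + d ≤ suc e + t
  c+d≤1+e+t = begin
    c + d     ≤⟨ +-mono-≤ c≤e d≤1+t ⟩
    e + suc t ≡⟨ +-suc e t ⟩
    suc e + t ∎
  t≤1+e : t ≤ suc e
  t≤1+e = +-cancelʳ-≤ t t (suc e) (≤-trans t+t≤c+d c+d≤1+e+t)
  t≡a×t≡b : t ≡ a × t ≡ b
  t≡a×t≡b = +-tight t≤a t≤b (begin
    a + b     ≡⟨ ∣r∩p∣+∣r∩q∣≡∣r∩[p∩q]∣+∣r∩[p∪q]∣ T A B ⟩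
    c + d     ≤⟨ c+d≤1+e+t ⟩
    suc e + t ≤⟨ +-monoˡ-≤ t ∣A∩B∣<t ⟩
    t + t     ∎)
  c≡e×d≡1+t : c ≡ e × d ≡ suc t
  c≡e×d≡1+t = +-tight c≤e d≤1+t (begin
    e + suc t ≡⟨ +-suc e t ⟩
    suc e + t ≤⟨ +-monoˡ-≤ t ∣A∩B∣<t ⟩
    t + t     ≤⟨ t+t≤c+d ⟩
    c + d     ∎)
  T∩[A∩B]≡A∩B : T ∩ (A ∩ B) ≡ A ∩ B
  T∩[A∩B]≡A∩B = p⊆q∧∣q∣≤∣p∣⇒p≡q (p∩q⊆q T (A ∩ B)) (≤-reflexive (sym (proj₁ c≡e×d≡1+t)))
  T∩[A∪B]≡T : T ∩ (A ∪ B) ≡ T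
  T∩[A∪B]≡T = p⊆q∧∣q∣≤∣p∣⇒p≡q (p∩q⊆p T (A ∪ B))
                (≤-reflexive (trans ∣T∣≡1+t (sym (proj₂ c≡e×d≡1+t))))

same-half : ∀ {n t} {A B T T′ : Subset n} →
            Straddles t A B T → Straddles t A B T′ → t ≤ ∣ T ∩ T′ ∣ →
            T ∩ A ≡ T′ ∩ A ⊎ T ∩ B ≡ T′ ∩ B
same-half {n} {t} {A} {B} {T} {T′} sT sT′ t≤∣X∣ =
  Sum.map (agree A (∣T∩A∣≡t sT) (∣T∩A∣≡t sT′)) (agree B (∣T∩B∣≡t sT) (∣T∩B∣≡t sT′))
          (m+n<o+p⇒m<o⊎n<p e+e<∣X∩A∣+∣X∩B∣)
  where
  open ≤-Reasoning
  X : Subset n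
  X = T ∩ T′
  e : ℕ
  e = ∣ A ∩ B ∣
  e+e<∣X∩A∣+∣X∩B∣ : e + e < ∣ X ∩ A ∣ + ∣ X ∩ B ∣
  e+e<∣X∩A∣+∣X∩B∣ = begin-strict
    e + e                             <⟨ +-monoʳ-< e (≤-trans (≤-reflexive (suc∣A∩B∣≡t sT)) t≤∣X∣) ⟩
    e + ∣ X ∣                         ≤⟨ +-mono-≤ (p⊆q⇒∣p∣≤∣q∣ A∩B⊆X∩[A∩B]) (p⊆q⇒∣p∣≤∣q∣ X⊆X∩[A∪B]) ⟩
    ∣ X ∩ (A ∩ B) ∣ + ∣ X ∩ (A ∪ B) ∣ ≡⟨ ∣r∩p∣+∣r∩q∣≡∣r∩[p∩q]∣+∣r∩[p∪q]∣ X A B ⟨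
    ∣ X ∩ A ∣ + ∣ X ∩ B ∣             ∎
    where
    A∩B⊆X∩[A∩B] : A ∩ B ⊆ X ∩ (A ∩ B)
    A∩B⊆X∩[A∩B] = ⊆-∩ (⊆-∩ (A∩B⊆T sT) (A∩B⊆T sT′)) ⊆-refl
    X⊆X∩[A∪B] : X ⊆ X ∩ (A ∪ B)
    X⊆X∩[A∪B] = ⊆-∩ ⊆-refl (⊆-trans (p∩q⊆p T T′) (T⊆A∪B sT))
  agree : ∀ P → ∣ T ∩ P ∣ ≡ t → ∣ T′ ∩ P ∣ ≡ t → e < ∣ X ∩ P ∣ → T ∩ P ≡ T′ ∩ P
  agree P ∣T∩P∣≡t ∣T′∩P∣≡t e<∣X∩P∣ =
    trans (sym (fills T (p∩q⊆p T T′) ∣T∩P∣≡t)) (fills T′ (p∩q⊆q T T′) ∣T′∩P∣≡t)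
    where
    t≤∣X∩P∣ : t ≤ ∣ X ∩ P ∣
    t≤∣X∩P∣ = subst (_≤ ∣ X ∩ P ∣) (suc∣A∩B∣≡t sT) e<∣X∩P∣
    fills : ∀ S → X ⊆ S → ∣ S ∩ P ∣ ≡ t → X ∩ P ≡ S ∩ P
    fills S X⊆S ∣S∩P∣≡t = p⊆q∧∣q∣≤∣p∣⇒p≡q (⊆-∩ (⊆-trans (p∩q⊆p X P) X⊆S) (p∩q⊆q X P))
                                          (≤-trans (≤-reflexive ∣S∩P∣≡t) t≤∣X∩P∣)

same-halves⇒≡ : Straddles t A B T → Straddles t A B T′ → T ∩ A ≡ T′ ∩ A → T ∩ B ≡ T′ ∩ B → T ≡ T′
same-halves⇒≡ {T = T} {T′ = T′} sT sT′ A-half B-half = begin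
  T                     ≡⟨ p⊆q∪r⇒p≡p∩q∪p∩r (T⊆A∪B sT) ⟩
  (T ∩ _) ∪ (T ∩ _)     ≡⟨ cong₂ _∪_ A-half B-half ⟩
  (T′ ∩ _) ∪ (T′ ∩ _)   ≡⟨ p⊆q∪r⇒p≡p∩q∪p∩r (T⊆A∪B sT′) ⟨
  T′                    ∎
  where open ≡-Reasoning

module _ {A B : Subset n} {𝒯 : List (Subset n)}
         (straddling : ∀ {T} → T ∈ 𝒯 → Straddles t A B T)
         (intersecting : TIntersecting t 𝒯)
         {T₁ T₂ : Subset n} (T₁∈𝒯 : T₁ ∈ 𝒯) (T₂∈𝒯 : T₂ ∈ 𝒯) (T₁≢T₂ : T₁ ≢ T₂)
         (A-half : T₁ ∩ A ≡ T₂ ∩ A) where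

  private
    halves : T ∈ 𝒯 → T′ ∈ 𝒯 → T ∩ A ≡ T′ ∩ A ⊎ T ∩ B ≡ T′ ∩ B
    halves T∈𝒯 T′∈𝒯 = same-half (straddling T∈𝒯) (straddling T′∈𝒯) (intersecting T∈𝒯 T′∈𝒯)

  common-half : T ∈ 𝒯 → T ∩ A ≡ T₁ ∩ A
  common-half T∈𝒯 with halves T∈𝒯 T₁∈𝒯 | halves T∈𝒯 T₂∈𝒯
  ... | inj₁ A₁ | _       = A₁
  ... | inj₂ _  | inj₁ A₂ = trans A₂ (sym A-half)
  ... | inj₂ B₁ | inj₂ B₂ =
    ⊥-elim (T₁≢T₂ (same-halves⇒≡ (straddling T₁∈𝒯) (straddling T₂∈𝒯) A-half (trans (sym B₁) B₂)))

  ⋂-inChoose : ∣ T₁ ∣ ≡ suc t → ∣ T₂ ∣ ≡ suc t → InChoose A t (⋂ 𝒯)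
  ⋂-inChoose ∣T₁∣≡1+t ∣T₂∣≡1+t = subst (InChoose A t) K≡⋂𝒯 (p∩q⊆q T₁ A , ∣K∣≡t)
    where
    K : Subset n
    K = T₁ ∩ A
    ∣K∣≡t : ∣ K ∣ ≡ t
    ∣K∣≡t = ∣T∩A∣≡t (straddling T₁∈𝒯)
    K⊆⋂𝒯 : K ⊆ ⋂ 𝒯
    K⊆⋂𝒯 = ⊆-⋂ (λ T∈𝒯 → subst (_⊆ _) (common-half T∈𝒯) (p∩q⊆p _ A))
    ∣T₁∩T₂∣≤t : ∣ T₁ ∩ T₂ ∣ ≤ t
    ∣T₁∩T₂∣≤t = s≤s⁻¹ (subst (∣ T₁ ∩ T₂ ∣ <_) ∣T₁∣≡1+t
                  (∣p∣≡∣q∣∧p≢q⇒∣p∩q∣<∣p∣ (trans ∣T₁∣≡1+t (sym ∣T₂∣≡1+t)) T₁≢T₂))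
    K≡⋂𝒯 : K ≡ ⋂ 𝒯
    K≡⋂𝒯 = p⊆q∧∣q∣≤∣p∣⇒p≡q K⊆⋂𝒯 (begin
      ∣ ⋂ 𝒯 ∣     ≤⟨ p⊆q⇒∣p∣≤∣q∣ (⊆-∩ (⋂-⊆ T₁∈𝒯) (⋂-⊆ T₂∈𝒯)) ⟩
      ∣ T₁ ∩ T₂ ∣ ≤⟨ ∣T₁∩T₂∣≤t ⟩
      t           ≡⟨ ∣K∣≡t ⟨
      ∣ K ∣       ∎)
      where open ≤-Reasoning

lemma4p2 : (n t : ℕ) → t ≥ 1 → n ≥ t + 2 →
    (𝒯 : List (Subset n)) → Unique 𝒯 → Uniform (suc t) 𝒯 →
    TIntersecting t 𝒯 → length 𝒯 ≥ 2 →
    (A B : Subset n) → TCover t 𝒯 A → TCover t 𝒯 B → ∣ A ∩ B ∣ < t →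
    InChoose A t (⋂ 𝒯) ⊎ InChoose B t (⋂ 𝒯)
lemma4p2 _ _ _ _ []        _ _ _ ()         _ _ _ _ _
lemma4p2 _ _ _ _ (_ ∷ [])  _ _ _ (s≤s ())   _ _ _ _ _
lemma4p2 _ t _ _ 𝒯@(T₁ ∷ T₂ ∷ _) ((T₁≢T₂ ∷ _) ∷ _) uniform intersecting _ A B coverA coverB ∣A∩B∣<t =
  Sum.map (λ A-half → ⋂-inChoose straddlingAB intersecting T₁∈𝒯 T₂∈𝒯 T₁≢T₂ A-half ∣T₁∣≡1+t ∣T₂∣≡1+t)
          (λ B-half → ⋂-inChoose straddlingBA intersecting T₁∈𝒯 T₂∈𝒯 T₁≢T₂ B-half ∣T₁∣≡1+t ∣T₂∣≡1+t)
          (same-half (straddlingAB T₁∈𝒯) (straddlingAB T₂∈𝒯) (intersecting T₁∈𝒯 T₂∈𝒯))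
  where
  T₁∈𝒯 : T₁ ∈ 𝒯
  T₁∈𝒯 = here refl
  T₂∈𝒯 : T₂ ∈ 𝒯
  T₂∈𝒯 = there (here refl)
  ∣T₁∣≡1+t : ∣ T₁ ∣ ≡ suc t
  ∣T₁∣≡1+t = uniform T₁∈𝒯
  ∣T₂∣≡1+t : ∣ T₂ ∣ ≡ suc t
  ∣T₂∣≡1+t = uniform T₂∈𝒯
  straddlingAB : ∀ {T} → T ∈ 𝒯 → Straddles t A B T
  straddlingAB T∈𝒯 = straddles (uniform T∈𝒯) (coverA T∈𝒯) (coverB T∈𝒯) ∣A∩B∣<t
  straddlingBA : ∀ {T} → T ∈ 𝒯 → Straddles t B A T
  straddlingBA T∈𝒯 = straddles (uniform T∈𝒯) (coverB T∈𝒯) (coverA T∈𝒯)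
                                (subst (_< t) (cong ∣_∣ (∩-comm A B)) ∣A∩B∣<t)
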